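{- Let $n=2k$ with $k\geq 2$ and let $S_n$ be the $n$-sunlet graph. Then $\psi_E(S_n)=3$.
   Context: All graphs are simple, connected and undirected. The $n$-sunlet graph $S_n$ is obtained from the cycle $C_n$ by attaching one pendant edge at each vertex of the cycle. For a graph $G$, the edge distance $d_E(f,g)$ between edges $f,g\in E(G)$ is the distance between $f$ and $g$ as vertices of the line graph $L(G)$. Two edges $f,g$ are said to edge doubly resolve edges $f_1,f_2$ if $d_E(f_1,f)-d_E(f_1,g)\neq d_E(f_2,f)-d_E(f_2,g)$. A set $D_E\subseteq E(G)$ is an edge version of doubly resolving set of $G$ if every pair of distinct edges $e\neq f$ of $G$ is edge doubly resolved by some two edges of $D_E$. $\psi_E(G)$ denotes the minimum cardinality of an edge version of doubly resolving set of $G$. -}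

module Defs where

open import Data.Nat using (ℕ; zero; suc; _+_; _≤_; _<_)
open import Data.Nat.DivMod using (_%_; m%n<n)
open import Data.Fin using (Fin; toℕ; fromℕ<; _↑ˡ_; _↑ʳ_; splitAt)
open import Data.Fin.Subset using (Subset; _∈_; ∣_∣)
open import Data.Integer as ℤ using (ℤ; +_; _-_)
open import Data.Product using (_×_; _,_; proj₁; proj₂; Σ; ∃)
open import Data.Sum using (_⊎_; inj₁; inj₂)
open import Relation.Binary.PropositionalEquality using (_≡_; _≢_)

record Graph : Set where
  field
    V E  : ℕ
    ends : Fin E → Fin V × Fin V

open Graph public

-- Adjacency in the line graph L(G): distinct edges sharing an endpoint.
SharesEnd : (G : Graph) → Fin (E G) → Fin (E G) → Set
SharesEnd G e f =
  let (a , b) = ends G e ; (c , d) = ends G f in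
  (a ≡ c) ⊎ (a ≡ d) ⊎ (b ≡ c) ⊎ (b ≡ d)

LAdj : (G : Graph) → Fin (E G) → Fin (E G) → Set
LAdj G e f = e ≢ f × SharesEnd G e f

data LWalk (G : Graph) : Fin (E G) → Fin (E G) → ℕ → Set where
  here : ∀ {e} → LWalk G e e 0
  step : ∀ {e e' f l} → LAdj G e e' → LWalk G e' f l → LWalk G e f (suc l)

EdgeDist : (G : Graph) → Fin (E G) → Fin (E G) → ℕ → Set
EdgeDist G e f d = LWalk G e f d × (∀ l → LWalk G e f l → d ≤ l)

EdgeDoublyResolves : (G : Graph) → (f g f₁ f₂ : Fin (E G)) → Set
EdgeDoublyResolves G f g f₁ f₂ =
  ∀ a b c d → EdgeDist G f₁ f a → EdgeDist G f₁ g b →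
              EdgeDist G f₂ f c → EdgeDist G f₂ g d →
              (+ a - + b) ≢ (+ c - + d)

IsEdgeDRS : (G : Graph) → Subset (E G) → Set
IsEdgeDRS G D = ∀ e e' → e ≢ e' →
  Σ (Fin (E G)) λ f → Σ (Fin (E G)) λ g →
    f ∈ D × g ∈ D × EdgeDoublyResolves G f g e e'

PsiE≡ : Graph → ℕ → Set
PsiE≡ G r =
  (Σ (Subset (E G)) λ D → IsEdgeDRS G D × ∣ D ∣ ≡ r)
  × (∀ D → IsEdgeDRS G D → r ≤ ∣ D ∣)

-- Vertices: cycle vertices c_i = i ↑ˡ n
-- and pendant vertices p_i = n ↑ʳ i (i : Fin n).  Edges: Fin (n + n):
-- the first n are cycle edges c_i c_{i+1 mod n}, the last n are the
-- pendant edges c_i p_i.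

cnext : ∀ {n} → Fin n → Fin n
cnext {suc n} i = fromℕ< (m%n<n (suc (toℕ i)) (suc n))

sunletEnds : (n : ℕ) → Fin (n + n) → Fin (n + n) × Fin (n + n)
sunletEnds n e with splitAt n e
... | inj₁ i = (i ↑ˡ n) , (cnext i ↑ˡ n)
... | inj₂ i = (i ↑ˡ n) , (n ↑ʳ i)

sunlet : ℕ → Graph
sunlet n = record { V = n + n ; E = n + n ; ends = sunletEnds n }

module Submission where

-- If every edge distance is at most Δ and there are more
-- than 2Δ + 1 edges, then for any two edges a, b the difference d(x,a) − d(x,b) takes at
-- most 2 d(a,b) + 1 ≤ 2Δ + 1 values, so by pigeonhole two distinct edges x, y share it
-- and no pair drawn from {a, b} doubly resolves them.  In L(S_n) all distances are at
-- most k + 1 and 2(k + 1) + 1 < 4k = |E(S_n)|, so every edge DRS has at least 3 edges.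
--
-- Distances to a cycle edge are computed exactly by a potential
-- certificate: δ(d) = min(d, n − d) for a cycle edge at cyclic offset d, and one more than
-- min(δ(d), δ(d − 1)) for a pendant edge.  For the cycle edges e₀, e₁, e_k, the sum
-- d(x,e₀) + d(x,e_k) is k on cycle edges and k + 1 on pendant edges, so an edge pair
-- unresolved by (e_k, e₀) has equal kind and equal distance to e₀; if it is also
-- unresolved by (e₁, e₀) the distances to e₀ and e₁ agree, and they determine the edge.

open import Defs
open import Data.Bool using (if_then_else_)
open import Data.Empty using (⊥; ⊥-elim)
open import Data.Fin as Fin using (Fin; toℕ; fromℕ<; _↑ˡ_; _↑ʳ_; splitAt)
import Data.Fin.Properties as FinP
open import Data.Fin.Subset using (Subset; _∈_; _∉_; ∣_∣; inside; outside; _∪_; ⁅_⁆)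
open import Data.Fin.Subset.Properties using (∪-identityʳ; x∈⁅x⁆; x∈⁅y⁆⇒x≡y; ∣⁅x⁆∣≡1; x∈p∪q⁺; x∈p∪q⁻)
open import Data.Integer as ℤ using (+_; _-_)
open import Data.Integer.Properties using (pos-+; +-injective)
import Data.Integer.Tactic.RingSolver as ℤ-Solver
open import Data.List using (List; []; _∷_; length; map)
open import Data.List.Membership.Propositional using () renaming (_∈_ to _∈ₗ_)
open import Data.List.Membership.Propositional.Properties using (∈-map⁺)
open import Data.List.Properties using (length-map)
open import Data.List.Relation.Unary.Any using (here; there)
open import Data.Nat
open import Data.Nat.DivMod
open import Data.Nat.Properties
open import Algebra.Properties.CommutativeSemigroup +-commutativeSemigroup using (xy∙z≈xz∙y)
import Data.Nat.Tactic.RingSolver as ℕ-Solver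
open import Data.Product using (_×_; _,_; proj₁; proj₂; Σ; ∃)
open import Data.Sum using (_⊎_; inj₁; inj₂; swap)
open import Data.Vec as Vec using ([]; _∷_)
open import Relation.Binary.PropositionalEquality
open import Relation.Nullary using (¬_; Dec; yes; no; does)
open import Relation.Nullary.Decidable using (_×-dec_; _⊎-dec_; ¬?; dec-true; dec-false)

module _ {P : ℕ → Set} (P? : ∀ l → Dec (P l)) where

  least-upto : ∀ l → (Σ ℕ λ d → d ≤ l × P d × (∀ m → P m → d ≤ m)) ⊎ (∀ m → m ≤ l → ¬ P m)
  least-upto zero with P? 0
  ... | yes p = inj₁ (0 , z≤n , p , λ _ _ → z≤n)
  ... | no ¬p = inj₂ λ { .0 z≤n → ¬p }
  least-upto (suc l) with least-upto l
  ... | inj₁ (d , d≤l , p , min) = inj₁ (d , m≤n⇒m≤1+n d≤l , p , min)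
  ... | inj₂ none with P? (suc l)
  ...   | yes p = inj₁ (suc l , ≤-refl , p , above)
    where
    above : ∀ m → P m → suc l ≤ m
    above m pm with suc l ≤? m
    ... | yes 1+l≤m = 1+l≤m
    ... | no 1+l≰m = ⊥-elim (none m (s≤s⁻¹ (≰⇒> 1+l≰m)) pm)
  ...   | no ¬p = inj₂ none-up-to
    where
    none-up-to : ∀ m → m ≤ suc l → ¬ P m
    none-up-to m m≤1+l with m≤n⇒m<n∨m≡n m≤1+l
    ... | inj₁ m<1+l = none m (s≤s⁻¹ m<1+l)
    ... | inj₂ refl  = ¬p

  least : ∀ {l} → P l → Σ ℕ λ d → d ≤ l × P d × (∀ m → P m → d ≤ m)
  least {l} p with least-upto l
  ... | inj₁ w = w
  ... | inj₂ none = ⊥-elim (none l ≤-refl p)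

module EdgeDistance (G : Graph) where

  LAdj-sym : ∀ {e f} → LAdj G e f → LAdj G f e
  LAdj-sym (e≢f , inj₁ p)                 = (λ q → e≢f (sym q)) , inj₁ (sym p)
  LAdj-sym (e≢f , inj₂ (inj₁ p))          = (λ q → e≢f (sym q)) , inj₂ (inj₂ (inj₁ (sym p)))
  LAdj-sym (e≢f , inj₂ (inj₂ (inj₁ p)))   = (λ q → e≢f (sym q)) , inj₂ (inj₁ (sym p))
  LAdj-sym (e≢f , inj₂ (inj₂ (inj₂ p)))   = (λ q → e≢f (sym q)) , inj₂ (inj₂ (inj₂ (sym p)))

  snoc : ∀ {x y z l} → LWalk G x y l → LAdj G y z → LWalk G x z (suc l)
  snoc here       a = step a here
  snoc (step a w) b = step a (snoc w b)

  reverse : ∀ {x y l} → LWalk G x y l → LWalk G y x l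
  reverse here       = here
  reverse (step a w) = snoc (reverse w) (LAdj-sym a)

  append : ∀ {x y z l m} → LWalk G x y l → LWalk G y z m → LWalk G x z (l + m)
  append here       v = v
  append (step a w) v = step a (append w v)

  dist-unique : ∀ {x y d d'} → EdgeDist G x y d → EdgeDist G x y d' → d ≡ d'
  dist-unique (w , min) (w' , min') = ≤-antisym (min _ w') (min' _ w)

  dist-sym : ∀ {x y d} → EdgeDist G x y d → EdgeDist G y x d
  dist-sym (w , min) = reverse w , λ l v → min l (reverse v)

  dist-triangle : ∀ {x y z d₁ d₂ d} →
    EdgeDist G x y d₁ → EdgeDist G y z d₂ → EdgeDist G x z d → d ≤ d₁ + d₂
  dist-triangle (w , _) (v , _) (_ , min) = min _ (append w v)

  LAdj? : ∀ e f → Dec (LAdj G e f)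
  LAdj? e f = ¬? (e Fin.≟ f) ×-dec shares (ends G e) (ends G f)
    where
    shares : ∀ p q → Dec ((proj₁ p ≡ proj₁ q) ⊎ (proj₁ p ≡ proj₂ q) ⊎ (proj₂ p ≡ proj₁ q) ⊎ (proj₂ p ≡ proj₂ q))
    shares (a , b) (c , d) = (a Fin.≟ c) ⊎-dec (a Fin.≟ d) ⊎-dec (b Fin.≟ c) ⊎-dec (b Fin.≟ d)

  walk? : ∀ l e f → Dec (LWalk G e f l)
  walk? zero e f with e Fin.≟ f
  ... | yes refl = yes here
  ... | no e≢f   = no λ { here → e≢f refl }
  walk? (suc l) e f with FinP.any? (λ e' → LAdj? e e' ×-dec walk? l e' f)
  ... | yes (e' , a , w) = yes (step a w)
  ... | no ¬w            = no λ { (step a w) → ¬w (_ , a , w) }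

  dist-from-walk : ∀ {e f l} → LWalk G e f l → Σ ℕ λ d → EdgeDist G e f d × d ≤ l
  dist-from-walk {e} {f} w with least (λ l → walk? l e f) w
  ... | d , d≤l , v , min = d , (v , min) , d≤l

  module Potential (t : Fin (E G)) (F : Fin (E G) → ℕ)
    (F-zero : ∀ x → F x ≡ 0 → x ≡ t) (F-t : F t ≡ 0)
    (F-lip : ∀ x y → LAdj G x y → F x ≤ suc (F y))
    (F-desc : ∀ x m → F x ≡ suc m → Σ (Fin (E G)) λ y → LAdj G x y × F y ≡ m) where

    lower : ∀ {x l} → LWalk G x t l → F x ≤ l
    lower here                = ≤-reflexive F-t
    lower (step {e' = y} a w) = ≤-trans (F-lip _ y a) (s≤s (lower w))

    descend : ∀ m x → F x ≡ m → LWalk G x t m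
    descend zero    x Fx≡0 = subst (λ z → LWalk G z t 0) (sym (F-zero x Fx≡0)) here
    descend (suc m) x Fx≡1+m with F-desc x m Fx≡1+m
    ... | y , a , Fy≡m = step a (descend m y Fy≡m)

    potential-dist : ∀ x → EdgeDist G x t (F x)
    potential-dist x = descend (F x) x refl , λ l w → lower w

diff≡⇒cross≡ : ∀ a b c d → (+ a - + b) ≡ (+ c - + d) → a + d ≡ c + b
diff≡⇒cross≡ a b c d eq = +-injective (begin
  + (a + d)                   ≡⟨ pos-+ a d ⟩
  + a ℤ.+ + d                 ≡⟨ regroup (+ a) (+ b) (+ d) ⟩
  (+ a - + b) ℤ.+ (+ b ℤ.+ + d) ≡⟨ cong (ℤ._+ (+ b ℤ.+ + d)) eq ⟩
  (+ c - + d) ℤ.+ (+ b ℤ.+ + d) ≡⟨ regroup′ (+ c) (+ b) (+ d) ⟩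
  + c ℤ.+ + b                 ≡⟨ pos-+ c b ⟨
  + (c + b)                   ∎)
  where
  open ≡-Reasoning
  regroup : ∀ x y z → x ℤ.+ z ≡ (x - y) ℤ.+ (y ℤ.+ z)
  regroup = ℤ-Solver.solve-∀
  regroup′ : ∀ x y z → (x - z) ℤ.+ (y ℤ.+ z) ≡ x ℤ.+ y
  regroup′ = ℤ-Solver.solve-∀

cross≡⇒diff≡ : ∀ a b c d → a + d ≡ c + b → (+ a - + b) ≡ (+ c - + d)
cross≡⇒diff≡ a b c d eq = begin
  + a - + b                     ≡⟨ regroup (+ a) (+ b) (+ d) ⟩
  (+ a ℤ.+ + d) - (+ b ℤ.+ + d) ≡⟨ cong (_- (+ b ℤ.+ + d)) (trans (sym (pos-+ a d)) (trans (cong +_ eq) (pos-+ c b))) ⟩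
  (+ c ℤ.+ + b) - (+ b ℤ.+ + d) ≡⟨ regroup′ (+ c) (+ b) (+ d) ⟩
  + c - + d                     ∎
  where
  open ≡-Reasoning
  regroup : ∀ x y z → x - y ≡ (x ℤ.+ z) - (y ℤ.+ z)
  regroup = ℤ-Solver.solve-∀
  regroup′ : ∀ x y z → (x ℤ.+ y) - (y ℤ.+ z) ≡ x - z
  regroup′ = ℤ-Solver.solve-∀

module DoubleResolution (G : Graph) where
  open EdgeDistance G

  resolves : ∀ {f g x y a b c d} →
    EdgeDist G x f a → EdgeDist G x g b → EdgeDist G y f c → EdgeDist G y g d →
    a + d ≢ c + b → EdgeDoublyResolves G f g x y
  resolves {a = a} {b} {c} {d} xf xg yf yg cross≢ a' b' c' d' xf' xg' yf' yg' eq
    rewrite dist-unique xf' xf | dist-unique xg' xg | dist-unique yf' yf | dist-unique yg' yg =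
    cross≢ (diff≡⇒cross≡ a b c d eq)

  unresolved : ∀ {f g x y a b c d} →
    EdgeDist G x f a → EdgeDist G x g b → EdgeDist G y f c → EdgeDist G y g d →
    a + d ≡ c + b → ¬ EdgeDoublyResolves G f g x y
  unresolved {a = a} {b} {c} {d} xf xg yf yg cross≡ r =
    r a b c d xf xg yf yg (cross≡⇒diff≡ a b c d cross≡)

members : ∀ {m} → Subset m → List (Fin m)
members []            = []
members (inside ∷ D)  = Fin.zero ∷ map Fin.suc (members D)
members (outside ∷ D) = map Fin.suc (members D)

length-members : ∀ {m} (D : Subset m) → length (members D) ≡ ∣ D ∣
length-members []            = refl
length-members (inside ∷ D)  = cong suc (trans (length-map Fin.suc (members D)) (length-members D))
length-members (outside ∷ D) = trans (length-map Fin.suc (members D)) (length-members D)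

∈-members : ∀ {m} (D : Subset m) {f} → f ∈ D → f ∈ₗ members D
∈-members (inside ∷ D)  Vec.here      = here refl
∈-members (inside ∷ D)  (Vec.there p) = there (∈-map⁺ Fin.suc (∈-members D p))
∈-members (outside ∷ D) (Vec.there p) = ∈-map⁺ Fin.suc (∈-members D p)

within-pair : ∀ {m} → Fin m → (D : Subset m) → ∣ D ∣ ≤ 2 →
  Σ (Fin m) λ a → Σ (Fin m) λ b → ∀ f → f ∈ D → f ≡ a ⊎ f ≡ b
within-pair {m} default D ∣D∣≤2 = pair (members D) (length-members D) (∈-members D)
  where
  pair : (L : List (Fin m)) → length L ≡ ∣ D ∣ → (∀ {f} → f ∈ D → f ∈ₗ L) →
    Σ (Fin m) λ a → Σ (Fin m) λ b → ∀ f → f ∈ D → f ≡ a ⊎ f ≡ b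
  pair []          _   mem = default , default , λ f f∈D → case-nil (mem f∈D)
    where
    case-nil : ∀ {f} → f ∈ₗ [] → f ≡ default ⊎ f ≡ default
    case-nil ()
  pair (a ∷ [])     _   mem = a , a , λ f f∈D → case-one (mem f∈D)
    where
    case-one : ∀ {f} → f ∈ₗ a ∷ [] → f ≡ a ⊎ f ≡ a
    case-one (here f≡a) = inj₁ f≡a
  pair (a ∷ b ∷ []) _   mem = a , b , λ f f∈D → case-two (mem f∈D)
    where
    case-two : ∀ {f} → f ∈ₗ a ∷ b ∷ [] → f ≡ a ⊎ f ≡ b
    case-two (here f≡a)         = inj₁ f≡a
    case-two (there (here f≡b)) = inj₂ f≡b
  pair (_ ∷ _ ∷ _ ∷ _) len _ = ⊥-elim (<⇒≱ (s≤s (s≤s (s≤s z≤n))) (≤-trans (≤-reflexive len) ∣D∣≤2))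

cross-from-shift : ∀ P Q P' Q' K v → P + K ≡ v + Q → P' + K ≡ v + Q' → P + Q' ≡ P' + Q
cross-from-shift P Q P' Q' K v e e' = +-cancelʳ-≡ K _ _ (begin
  P + Q' + K   ≡⟨ xy∙z≈xz∙y P Q' K ⟩
  P + K + Q'   ≡⟨ cong (_+ Q') e ⟩
  v + Q + Q'   ≡⟨ xy∙z≈xz∙y v Q Q' ⟩
  v + Q' + Q   ≡⟨ cong (_+ Q) e' ⟨
  P' + K + Q   ≡⟨ xy∙z≈xz∙y P' K Q ⟩
  P' + Q + K   ∎)
  where open ≡-Reasoning

module LowerBound (G : Graph) (dist : Fin (E G) → Fin (E G) → ℕ)
  (dist-ok : ∀ x y → EdgeDist G x y (dist x y)) (Δ : ℕ) (dist≤Δ : ∀ x y → dist x y ≤ Δ)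
  (many-edges : suc (Δ + Δ) < E G) where
  open EdgeDistance G
  open DoubleResolution G

  indistinguishable : ∀ a b → Σ (Fin (E G)) λ x → Σ (Fin (E G)) λ y →
    x ≢ y × dist x a + dist y b ≡ dist y a + dist x b
  indistinguishable a b = x , y , x≢y , cross-from-shift _ _ _ _ K (value x) (shift x) (trans (shift y) (cong (_+ dist y b) (sym same-value)))
    where
    K : ℕ
    K = dist a b
    -- value x = d(x,a) − d(x,b) + K, which lies in [0, 2K].
    value : Fin (E G) → ℕ
    value x = dist x a + K ∸ dist x b
    shift : ∀ x → dist x a + K ≡ value x + dist x b
    shift x = sym (m∸n+n≡m (dist-triangle (dist-ok x a) (dist-ok a b) (dist-ok x b)))
    value< : ∀ x → value x < suc (K + K)
    value< x = s≤s (begin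
      dist x a + K ∸ dist x b            ≤⟨ ∸-monoˡ-≤ (dist x b) (+-monoˡ-≤ K (dist-triangle (dist-ok x b) (dist-sym (dist-ok a b)) (dist-ok x a))) ⟩
      dist x b + K + K ∸ dist x b        ≡⟨ cong (_∸ dist x b) (+-assoc (dist x b) K K) ⟩
      dist x b + (K + K) ∸ dist x b      ≡⟨ m+n∸m≡n (dist x b) (K + K) ⟩
      K + K                              ∎)
      where open ≤-Reasoning
    collision : ∃ λ x → ∃ λ y → x Fin.< y × fromℕ< (value< x) ≡ fromℕ< (value< y)
    collision = FinP.pigeonhole (≤-<-trans (s≤s (+-mono-≤ (dist≤Δ a b) (dist≤Δ a b))) many-edges) (λ x → fromℕ< (value< x))
    x y : Fin (E G)
    x = proj₁ collision
    y = proj₁ (proj₂ collision)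
    x≢y : x ≢ y
    x≢y x≡y = <⇒≢ (proj₁ (proj₂ (proj₂ collision))) (cong toℕ x≡y)
    same-value : value x ≡ value y
    same-value = trans (sym (FinP.toℕ-fromℕ< (value< x)))
                   (trans (cong toℕ (proj₂ (proj₂ (proj₂ collision)))) (FinP.toℕ-fromℕ< (value< y)))

  pair-fails : ∀ {a b x y} → dist x a + dist y b ≡ dist y a + dist x b →
    ∀ {f g} → (f ≡ a ⊎ f ≡ b) → (g ≡ a ⊎ g ≡ b) → ¬ EdgeDoublyResolves G f g x y
  pair-fails {a} {b} {x} {y} cross {f} {g} f∈ g∈ =
    unresolved (dist-ok x f) (dist-ok x g) (dist-ok y f) (dist-ok y g) (balanced f∈ g∈)
    where
    balanced : (f ≡ a ⊎ f ≡ b) → (g ≡ a ⊎ g ≡ b) → dist x f + dist y g ≡ dist y f + dist x g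
    balanced (inj₁ refl) (inj₁ refl) = +-comm (dist x f) (dist y f)
    balanced (inj₁ refl) (inj₂ refl) = cross
    balanced (inj₂ refl) (inj₁ refl) = trans (+-comm (dist x f) (dist y g)) (trans (sym cross) (+-comm (dist x g) (dist y f)))
    balanced (inj₂ refl) (inj₂ refl) = +-comm (dist x f) (dist y f)

  -- Any D with at most two members lies in a pair {a, b}, which fails on such x, y.
  at-least-three : ∀ D → IsEdgeDRS G D → 3 ≤ ∣ D ∣
  at-least-three D drs with 3 ≤? ∣ D ∣
  ... | yes 3≤∣D∣ = 3≤∣D∣
  ... | no 3≰∣D∣ = ⊥-elim (no-pair (within-pair (fromℕ< (≤-trans (s≤s z≤n) many-edges)) D (s≤s⁻¹ (≰⇒> 3≰∣D∣))))
    where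
    no-pair : (Σ (Fin (E G)) λ a → Σ (Fin (E G)) λ b → ∀ f → f ∈ D → f ≡ a ⊎ f ≡ b) → ⊥
    no-pair (a , b , D⊆ab) = separate (indistinguishable a b)
      where
      separate : (Σ (Fin (E G)) λ x → Σ (Fin (E G)) λ y → x ≢ y × dist x a + dist y b ≡ dist y a + dist x b) → ⊥
      separate (x , y , x≢y , cross) = refute (drs x y x≢y)
        where
        refute : (Σ (Fin (E G)) λ f → Σ (Fin (E G)) λ g → f ∈ D × g ∈ D × EdgeDoublyResolves G f g x y) → ⊥
        refute (f , g , f∈D , g∈D , r) = pair-fails cross (D⊆ab f f∈D) (D⊆ab g g∈D) r

∣∪⁅x⁆∣ : ∀ {m} (D : Subset m) (x : Fin m) → x ∉ D → ∣ D ∪ ⁅ x ⁆ ∣ ≡ suc ∣ D ∣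
∣∪⁅x⁆∣ (inside  ∷ D) Fin.zero    x∉D = ⊥-elim (x∉D Vec.here)
∣∪⁅x⁆∣ (outside ∷ D) Fin.zero    _   = cong (λ S → suc ∣ S ∣) (∪-identityʳ D)
∣∪⁅x⁆∣ (inside  ∷ D) (Fin.suc x) x∉D = cong suc (∣∪⁅x⁆∣ D x (λ x∈D → x∉D (Vec.there x∈D)))
∣∪⁅x⁆∣ (outside ∷ D) (Fin.suc x) x∉D = ∣∪⁅x⁆∣ D x (λ x∈D → x∉D (Vec.there x∈D))

steps-both : ∀ {a b} → a ≡ suc b ⊎ b ≡ suc a → a ≤ suc b × b ≤ suc a
steps-both (inj₁ refl) = ≤-refl , ≤-trans (n≤1+n _) (n≤1+n _)
steps-both (inj₂ refl) = ≤-trans (n≤1+n _) (n≤1+n _) , ≤-refl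

≤-suc-⊓ˡ : ∀ {a b} → a ≤ suc b → a ≤ suc (a ⊓ b)
≤-suc-⊓ˡ {a} a≤1+b = ⊓-glb (n≤1+n a) a≤1+b

≤-suc-⊓ʳ : ∀ {a b} → b ≤ suc a → b ≤ suc (a ⊓ b)
≤-suc-⊓ʳ {a} {b} b≤1+a = ⊓-glb b≤1+a (n≤1+n b)

balance : ∀ {A B K L k s t} → A + K ≡ k + s → B + L ≡ k + t → K + B ≡ L + A → s + 2 * B ≡ t + 2 * A
balance {A} {B} {K} {L} {k} {s} {t} eA eB eKL = +-cancelˡ-≡ k _ _ (begin
  k + (s + 2 * B)    ≡⟨ regroup₁ k s B ⟩
  (k + s) + B + B    ≡⟨ cong (λ z → z + B + B) (sym eA) ⟩
  (A + K) + B + B    ≡⟨ regroup₂ A K B ⟩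
  A + (K + B) + B    ≡⟨ cong (λ z → A + z + B) eKL ⟩
  A + (L + A) + B    ≡⟨ regroup₃ A L B ⟩
  (A + A) + (B + L)  ≡⟨ cong (λ z → (A + A) + z) eB ⟩
  (A + A) + (k + t)  ≡⟨ regroup₄ A k t ⟩
  k + (t + 2 * A)    ∎)
  where
  open ≡-Reasoning
  regroup₁ : ∀ k s B → k + (s + 2 * B) ≡ (k + s) + B + B
  regroup₁ = ℕ-Solver.solve-∀
  regroup₂ : ∀ A K B → (A + K) + B + B ≡ A + (K + B) + B
  regroup₂ = ℕ-Solver.solve-∀
  regroup₃ : ∀ A L B → A + (L + A) + B ≡ (A + A) + (B + L)
  regroup₃ = ℕ-Solver.solve-∀
  regroup₄ : ∀ A k t → (A + A) + (k + t) ≡ k + (t + 2 * A)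
  regroup₄ = ℕ-Solver.solve-∀

module Cyclic (k' : ℕ) where

  k n : ℕ
  k = suc (suc k')
  n = k + k

  next : ℕ → ℕ
  next d = suc d % n

  offset : ℕ → ℕ → ℕ
  offset a m = (a + (n ∸ m)) % n

  complement-≥ : ∀ {a b} → a + b ≡ n → a ≤ k → k ≤ b
  complement-≥ {a} {b} a+b≡n a≤k with k ≤? b
  ... | yes k≤b = k≤b
  ... | no  k≰b = ⊥-elim (<-irrefl a+b≡n (+-mono-≤-< a≤k (≰⇒> k≰b)))

  data Half (d : ℕ) : Set where
    near : d ≤ k → Half d
    far  : ∀ u → d + u ≡ n → u < k → Half d

  half : ∀ d → d < n → Half d
  half d d<n with d ≤? k
  ... | yes d≤k = near d≤k
  ... | no  d≰k = far (n ∸ d) (m+[n∸m]≡n (<⇒≤ d<n))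
                    (subst (n ∸ d <_) (m+n∸n≡m k k) (∸-monoʳ-< (≰⇒> d≰k) (<⇒≤ d<n)))

  data Next (d : ℕ) : Set where
    inner : suc d < n → next d ≡ suc d → Next d
    wrap  : suc d ≡ n → next d ≡ 0 → Next d

  next-view : ∀ d → d < n → Next d
  next-view d d<n with m≤n⇒m<n∨m≡n d<n
  ... | inj₁ 1+d<n = inner 1+d<n (m<n⇒m%n≡m 1+d<n)
  ... | inj₂ 1+d≡n = wrap 1+d≡n (trans (cong (_% n) 1+d≡n) (n%n≡0 n))

  -- δ d = min(d, n − d): the distance from d to 0 along the cycle.
  δ : ℕ → ℕ
  δ d = d ⊓ (n ∸ d)

  complement : ∀ {d u} → d + u ≡ n → n ∸ d ≡ u
  complement {d} {u} d+u≡n = trans (cong (_∸ d) (sym d+u≡n)) (m+n∸m≡n d u)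

  δ-near : ∀ {d} → d ≤ k → δ d ≡ d
  δ-near {d} d≤k = m≤n⇒m⊓n≡m (≤-trans d≤k (complement-≥ (m+[n∸m]≡n (≤-trans d≤k (m≤m+n k k))) d≤k))

  δ-far : ∀ {d u} → d + u ≡ n → u ≤ k → δ d ≡ u
  δ-far {d} {u} d+u≡n u≤k = trans (cong (d ⊓_) (complement d+u≡n))
    (m≥n⇒m⊓n≡n (≤-trans u≤k (complement-≥ (trans (+-comm u d) d+u≡n) u≤k)))

  δ-zero : ∀ {d} → d < n → δ d ≡ 0 → d ≡ 0
  δ-zero {d} d<n δd≡0 with half d d<n
  ... | near d≤k       = trans (sym (δ-near d≤k)) δd≡0
  ... | far u d+u≡n u<k = ⊥-elim (<-irrefl (trans (sym (+-identityʳ d)) (trans (cong (λ v → d + v) (sym u≡0)) d+u≡n)) d<n)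
    where
    u≡0 : u ≡ 0
    u≡0 = trans (sym (δ-far d+u≡n (<⇒≤ u<k))) δd≡0

  δ≤k : ∀ {d} → d < n → δ d ≤ k
  δ≤k {d} d<n with half d d<n
  ... | near d≤k        = subst (_≤ k) (sym (δ-near d≤k)) d≤k
  ... | far u d+u≡n u<k = subst (_≤ k) (sym (δ-far d+u≡n (<⇒≤ u<k))) (<⇒≤ u<k)

  δ-suc : ∀ {d} → suc d < n → δ (suc d) ≡ suc (δ d) ⊎ δ d ≡ suc (δ (suc d))
  δ-suc {d} 1+d<n with half (suc d) 1+d<n
  ... | near 1+d≤k          = inj₁ (trans (δ-near 1+d≤k) (cong suc (sym (δ-near (≤-trans (n≤1+n d) 1+d≤k)))))
  ... | far u 1+d+u≡n u<k = inj₂ (trans (δ-far (trans (+-suc d u) 1+d+u≡n) u<k) (cong suc (sym (δ-far 1+d+u≡n (<⇒≤ u<k)))))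

  δ-next : ∀ {d} → d < n → δ (next d) ≡ suc (δ d) ⊎ δ d ≡ suc (δ (next d))
  δ-next {d} d<n with next-view d d<n
  ... | inner 1+d<n next≡ rewrite next≡ = δ-suc 1+d<n
  ... | wrap  1+d≡n next≡ rewrite next≡ = inj₂ (δ-far (trans (+-comm d 1) 1+d≡n) (s≤s z≤n))

  δ-descent : ∀ {d m} → d < n → δ d ≡ suc m →
    δ (next d) ≡ m ⊎ Σ ℕ λ d' → d ≡ suc d' × δ d' ≡ m
  δ-descent {d} {m} d<n δd≡1+m with half d d<n
  ... | near d≤k = inj₂ (m , d≡1+m , δ-near (≤-trans (n≤1+n m) (subst (_≤ k) d≡1+m d≤k)))
    where
    d≡1+m : d ≡ suc m
    d≡1+m = trans (sym (δ-near d≤k)) δd≡1+m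
  ... | far u d+u≡n u<k with next-view d d<n
  ...   | inner _ next≡ = inj₁ (trans (cong δ next≡) (δ-far (trans (sym (+-suc d m)) (subst (λ v → d + v ≡ n) u≡1+m d+u≡n)) (≤-trans (n≤1+n m) (subst (_≤ k) u≡1+m (<⇒≤ u<k)))))
    where
    u≡1+m : u ≡ suc m
    u≡1+m = trans (sym (δ-far d+u≡n (<⇒≤ u<k))) δd≡1+m
  ...   | wrap 1+d≡n next≡ = inj₁ (trans (cong δ next≡) (sym m≡0))
    where
    m≡0 : m ≡ 0
    m≡0 = suc-injective (trans (sym δd≡1+m) (δ-far (trans (+-comm d 1) 1+d≡n) (s≤s z≤n)))

  -- π d = min(δ d, δ (d − 1)): one less than the distance, in the line graph of the
  -- sunlet, from the pendant edge at position d to the cycle edge at position 0.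
  π : ℕ → ℕ
  π zero    = 0
  π (suc d) = δ (suc d) ⊓ δ d

  π-next : ∀ {d} → d < n → π (next d) ≡ δ (next d) ⊓ δ d
  π-next {d} d<n with next-view d d<n
  ... | inner _ next≡ rewrite next≡ = refl
  ... | wrap  _ next≡ rewrite next≡ = refl

  π-near : ∀ {d} → suc d ≤ k → π (suc d) ≡ d
  π-near {d} 1+d≤k = trans (cong₂ _⊓_ (δ-near 1+d≤k) (δ-near (≤-trans (n≤1+n d) 1+d≤k)))
                           (m≥n⇒m⊓n≡n (n≤1+n d))

  π-far : ∀ {d u} → suc d + u ≡ n → u < k → π (suc d) ≡ u
  π-far {d} {u} 1+d+u≡n u<k = trans (cong₂ _⊓_ (δ-far 1+d+u≡n (<⇒≤ u<k)) (δ-far (trans (+-suc d u) 1+d+u≡n) u<k))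
                                    (m≤n⇒m⊓n≡m (n≤1+n u))

  π<k : ∀ {d} → d < n → π d < k
  π<k {zero}  _     = s≤s z≤n
  π<k {suc d} d<n with half (suc d) d<n
  ... | near 1+d≤k          = subst (_< k) (sym (π-near 1+d≤k)) 1+d≤k
  ... | far u 1+d+u≡n u<k = subst (_< k) (sym (π-far 1+d+u≡n u<k)) u<k

  next-injective : ∀ {a b} → a < n → b < n → next a ≡ next b → a ≡ b
  next-injective {a} {b} a<n b<n eq with next-view a a<n | next-view b b<n
  ... | inner _ ea  | inner _ eb  = suc-injective (trans (sym ea) (trans eq eb))
  ... | inner _ ea  | wrap  _ eb  = ⊥-elim (1+n≢0 (trans (sym ea) (trans eq eb)))
  ... | wrap  _ ea  | inner _ eb  = ⊥-elim (0≢1+n (trans (sym ea) (trans eq eb)))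
  ... | wrap  ea′ _ | wrap  eb′ _ = suc-injective (trans ea′ (sym eb′))

  next-≢ : ∀ {a} → a < n → a ≢ next a
  next-≢ {a} a<n a≡next with next-view a a<n
  ... | inner _ next≡    = 1+n≢n (sym (trans a≡next next≡))
  ... | wrap  1+a≡n next≡ = <-irrefl (trans (sym (cong suc (trans a≡next next≡))) 1+a≡n) (s≤s (s≤s z≤n))

  next-suc : ∀ {a d} → a < n → next a ≡ suc d → a ≡ d
  next-suc {a} a<n eq with next-view a a<n
  ... | inner _ next≡ = suc-injective (trans (sym next≡) eq)
  ... | wrap  _ next≡ = ⊥-elim (0≢1+n (trans (sym next≡) eq))

  next-onto : ∀ {i} → i < n → Σ ℕ λ j → j < n × next j ≡ i
  next-onto {zero}  _     = n ∸ 1 , ≤-refl , n%n≡0 n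
  next-onto {suc t} 1+t<n = t , <-trans (n<1+n t) 1+t<n , m<n⇒m%n≡m 1+t<n

  offset< : ∀ a m → offset a m < n
  offset< a m = m%n<n (a + (n ∸ m)) n

  offset-next : ∀ a m → offset (next a) m ≡ next (offset a m)
  offset-next a m = begin
    (suc a % n + (n ∸ m)) % n          ≡⟨ %-distribˡ-+ (suc a % n) (n ∸ m) n ⟩
    (suc a % n % n + (n ∸ m) % n) % n  ≡⟨ cong (λ z → (z + (n ∸ m) % n) % n) (m%n%n≡m%n (suc a) n) ⟩
    (suc a % n + (n ∸ m) % n) % n      ≡⟨ %-distribˡ-+ (suc a) (n ∸ m) n ⟨
    suc (a + (n ∸ m)) % n              ≡⟨ %-distribˡ-+ 1 (a + (n ∸ m)) n ⟩
    (1 % n + (a + (n ∸ m)) % n) % n     ≡⟨ cong (λ z → (1 % n + z) % n) (m%n%n≡m%n (a + (n ∸ m)) n) ⟨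
    (1 % n + offset a m % n) % n        ≡⟨ %-distribˡ-+ 1 (offset a m) n ⟨
    suc (offset a m) % n               ∎
    where open ≡-Reasoning

  offset-self : ∀ {m} → m < n → offset m m ≡ 0
  offset-self {m} m<n = trans (cong (_% n) (m+[n∸m]≡n (<⇒≤ m<n))) (n%n≡0 n)

  offset-zero : ∀ {a m} → a < n → m < n → offset a m ≡ 0 → a ≡ m
  offset-zero {a} {m} a<n m<n off≡0 with m ≤? a
  ... | yes m≤a = ≤-antisym (m∸n≡0⇒m≤n a∸m≡0) m≤a
    where
    shifted : a + (n ∸ m) ≡ (a ∸ m) + n
    shifted = trans (sym (+-∸-assoc a (<⇒≤ m<n)))
                (trans (cong (_∸ m) (+-comm a n)) (trans (+-∸-assoc n m≤a) (+-comm n (a ∸ m))))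
    a∸m≡0 : a ∸ m ≡ 0
    a∸m≡0 = trans (sym (m<n⇒m%n≡m (≤-<-trans (m∸n≤m a m) a<n)))
              (trans (sym ([m+n]%n≡m%n (a ∸ m) n)) (trans (cong (_% n) (sym shifted)) off≡0))
  ... | no m≰a = ⊥-elim (<⇒≱ m<n (m∸n≡0⇒m≤n (m+n≡0⇒n≡0 a (trans (sym (m<n⇒m%n≡m small)) off≡0))))
    where
    small : a + (n ∸ m) < n
    small = subst (a + (n ∸ m) <_) (m+[n∸m]≡n (<⇒≤ m<n)) (+-monoˡ-< (n ∸ m) (≰⇒> m≰a))

  offset-by-0 : ∀ {a} → a < n → offset a 0 ≡ a
  offset-by-0 {a} a<n = trans ([m+n]%n≡m%n a n) (m<n⇒m%n≡m a<n)

  offset-0-by-1 : offset 0 1 ≡ n ∸ 1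
  offset-0-by-1 = m<n⇒m%n≡m ≤-refl

  offset-suc-by-1 : ∀ {a} → suc a < n → offset (suc a) 1 ≡ a
  offset-suc-by-1 {a} 1+a<n = trans (cong (_% n) (sym (+-suc a (n ∸ 1))))
    (trans ([m+n]%n≡m%n a n) (m<n⇒m%n≡m (<-trans (n<1+n a) 1+a<n)))

  n∸k≡k : n ∸ k ≡ k
  n∸k≡k = m+n∸n≡m k k

  offset-low-by-k : ∀ {a} → a < k → offset a k ≡ a + k
  offset-low-by-k {a} a<k = trans (cong (λ z → (a + z) % n) n∸k≡k) (m<n⇒m%n≡m (+-monoˡ-< k a<k))

  offset-high-by-k : ∀ {r} → r + k < n → offset (r + k) k ≡ r
  offset-high-by-k {r} r+k<n = trans (cong (λ z → (r + k + z) % n) n∸k≡k)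
    (trans (cong (_% n) (+-assoc r k k))
      (trans ([m+n]%n≡m%n r n) (m<n⇒m%n≡m (≤-<-trans (m≤m+n r k) r+k<n))))

  antipode-sum : ∀ {r} → r ≤ k → r + k + (k ∸ r) ≡ n
  antipode-sum {r} r≤k = begin
    r + k + (k ∸ r)   ≡⟨ cong (_+ (k ∸ r)) (+-comm r k) ⟩
    k + r + (k ∸ r)   ≡⟨ +-assoc k r (k ∸ r) ⟩
    k + (r + (k ∸ r)) ≡⟨ cong (λ v → k + v) (m+[n∸m]≡n r≤k) ⟩
    n                 ∎
    where open ≡-Reasoning

  δ-antipode : ∀ {r} → r < k → δ r + δ (r + k) ≡ k
  δ-antipode {r} r<k = begin
    δ r + δ (r + k) ≡⟨ cong₂ _+_ (δ-near (<⇒≤ r<k)) (δ-far (antipode-sum (<⇒≤ r<k)) (m∸n≤m k r)) ⟩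
    r + (k ∸ r)     ≡⟨ m+[n∸m]≡n (<⇒≤ r<k) ⟩
    k               ∎
    where open ≡-Reasoning

  π-antipode : ∀ {r} → r < k → π r + π (r + k) ≡ suc k'
  π-antipode {zero}  _     = π-near ≤-refl
  π-antipode {suc r} 1+r<k = begin
    π (suc r) + π (suc r + k) ≡⟨ cong₂ _+_ (π-near (<⇒≤ 1+r<k)) (π-far (antipode-sum (<⇒≤ 1+r<k)) (∸-monoʳ-< (s≤s z≤n) (<⇒≤ 1+r<k))) ⟩
    r + (k ∸ suc r)           ≡⟨ suc-injective (m+[n∸m]≡n (<⇒≤ 1+r<k)) ⟩
    suc k'                    ∎
    where open ≡-Reasoning

  by-antipode : ∀ (f : ℕ → ℕ) {c} → (∀ {r} → r < k → f r + f (r + k) ≡ c) →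
    ∀ {a} → a < n → f a + f (offset a k) ≡ c
  by-antipode f {c} antipodal {a} a<n with a <? k
  ... | yes a<k = trans (cong (λ z → f a + f z) (offset-low-by-k a<k)) (antipodal a<k)
  ... | no  a≮k = begin
    f a + f (offset a k)        ≡⟨ cong (λ z → f z + f (offset z k)) a≡r+k ⟩
    f (r + k) + f (offset (r + k) k) ≡⟨ cong (λ z → f (r + k) + f z) (offset-high-by-k r+k<n) ⟩
    f (r + k) + f r             ≡⟨ +-comm (f (r + k)) (f r) ⟩
    f r + f (r + k)             ≡⟨ antipodal (+-cancelʳ-< k r k r+k<n) ⟩
    c                           ∎
    where
    open ≡-Reasoning
    r : ℕ
    r = a ∸ k
    a≡r+k : a ≡ r + k
    a≡r+k = sym (m∸n+n≡m (≮⇒≥ a≮k))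
    r+k<n : r + k < n
    r+k<n = subst (_< n) a≡r+k a<n

  if-≡ : ∀ {Q R x y : ℕ} → Q ≡ R → (if does (Q ≟ R) then x else y) ≡ x
  if-≡ {Q} {R} Q≡R rewrite dec-true (Q ≟ R) Q≡R = refl

  if-≢ : ∀ {Q R x y : ℕ} → Q ≢ R → (if does (Q ≟ R) then x else y) ≡ y
  if-≢ {Q} {R} Q≢R rewrite dec-false (Q ≟ R) Q≢R = refl

  -- A position a is recovered from δ a and δ (a − 1): on the near half
  -- δ (a − 1) = δ a − 1, on the far half δ (a − 1) = δ a + 1 and a = n − δ a.
  decodeδ : ℕ → ℕ → ℕ
  decodeδ zero    _ = 0
  decodeδ (suc P) Q = if does (Q ≟ suc (suc P)) then n ∸ suc P else suc P

  decodeδ-correct : ∀ {a} → a < n → decodeδ (δ a) (δ (offset a 1)) ≡ a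
  decodeδ-correct {zero}  _     = refl
  decodeδ-correct {suc a} 1+a<n with half (suc a) 1+a<n
  ... | near 1+a≤k = begin
    decodeδ (δ (suc a)) (δ (offset (suc a) 1)) ≡⟨ cong₂ decodeδ (δ-near 1+a≤k) (trans (cong δ (offset-suc-by-1 1+a<n)) (δ-near (≤-trans (n≤1+n a) 1+a≤k))) ⟩
    decodeδ (suc a) a                          ≡⟨ if-≢ {a} {suc (suc a)} (<⇒≢ (<-trans (n<1+n a) (n<1+n (suc a)))) ⟩
    suc a                                      ∎
    where open ≡-Reasoning
  ... | far zero 1+a+0≡n _ = ⊥-elim (<-irrefl (trans (sym (+-identityʳ (suc a))) 1+a+0≡n) 1+a<n)
  ... | far (suc u) 1+a+u≡n u<k = begin
    decodeδ (δ (suc a)) (δ (offset (suc a) 1)) ≡⟨ cong₂ decodeδ (δ-far {suc a} 1+a+u≡n (<⇒≤ u<k)) (trans (cong δ (offset-suc-by-1 1+a<n)) (δ-far {a} (trans (+-suc a (suc u)) 1+a+u≡n) u<k)) ⟩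
    decodeδ (suc u) (suc (suc u))              ≡⟨ if-≡ {suc (suc u)} refl ⟩
    n ∸ suc u                                  ≡⟨ complement {suc u} (trans (+-comm (suc u) (suc a)) 1+a+u≡n) ⟩
    suc a                                      ∎
    where open ≡-Reasoning

  δ-pair-injective : ∀ {a b} → a < n → b < n →
    δ a ≡ δ b → δ (offset a 1) ≡ δ (offset b 1) → a ≡ b
  δ-pair-injective a<n b<n e e₁ =
    trans (sym (decodeδ-correct a<n)) (trans (cong₂ decodeδ e e₁) (decodeδ-correct b<n))

  -- Likewise a position a is recovered from π a and π (a − 1); the two positions
  -- sharing a value of π (0 and 1, k and k + 1) are told apart by π (a − 1).
  decodeπ : ℕ → ℕ → ℕ
  decodeπ zero    zero    = 1
  decodeπ zero    (suc _) = 0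
  decodeπ (suc P) Q = if does (Q ≟ suc (suc P)) then n ∸ suc P
                      else if does (Q ≟ suc P) then suc k else suc (suc P)

  -- The far-half case a + 2 = n − u with u ≥ 1: there π (a + 1) is u or u + 1.
  decodeπ-far : ∀ {a u} → suc (suc a) + suc u ≡ n → suc u < k →
    decodeπ (suc u) (π (suc a)) ≡ suc (suc a)
  decodeπ-far {a} {u} e u<k with half (suc a) (≤-trans (m≤m+n (suc (suc a)) (suc u)) (≤-reflexive e))
  ... | near 1+a≤k = begin
    decodeπ (suc u) (π (suc a)) ≡⟨ cong (decodeπ (suc u)) (trans (π-near 1+a≤k) a≡1+u) ⟩
    decodeπ (suc u) (suc u)     ≡⟨ if-≢ {suc u} {suc (suc u)} (<⇒≢ (n<1+n (suc u))) ⟩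
    (if does (suc u ≟ suc u) then suc k else suc (suc u)) ≡⟨ if-≡ {suc u} refl ⟩
    suc k                       ≡⟨ cong suc (sym 1+a≡k) ⟩
    suc (suc a)                 ∎
    where
    open ≡-Reasoning
    e′ : suc a + suc (suc u) ≡ n
    e′ = trans (+-suc (suc a) (suc u)) e
    1+a≡k : suc a ≡ k
    1+a≡k = ≤-antisym 1+a≤k (complement-≥ (trans (+-comm (suc (suc u)) (suc a)) e′) u<k)
    a≡1+u : a ≡ suc u
    a≡1+u = suc-injective (trans 1+a≡k (sym (≤-antisym u<k (complement-≥ e′ 1+a≤k))))
  ... | far v e₂ v<k = begin
    decodeπ (suc u) (π (suc a)) ≡⟨ cong (decodeπ (suc u)) (trans (π-far {a} e₂ v<k) v≡2+u) ⟩
    decodeπ (suc u) (suc (suc u)) ≡⟨ if-≡ {suc (suc u)} refl ⟩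
    n ∸ suc u                   ≡⟨ complement {suc u} (trans (+-comm (suc u) (suc (suc a))) e) ⟩
    suc (suc a)                 ∎
    where
    open ≡-Reasoning
    v≡2+u : v ≡ suc (suc u)
    v≡2+u = +-cancelˡ-≡ (suc a) v (suc (suc u)) (trans e₂ (sym (trans (+-suc (suc a) (suc u)) e)))

  decodeπ-correct : ∀ {a} → a < n → decodeπ (π a) (π (offset a 1)) ≡ a
  decodeπ-correct {zero} _ = cong (decodeπ 0) (trans (cong π offset-0-by-1)
    (π-far {k' + k} {1} (+-comm (suc (k' + k)) 1) (s≤s (s≤s z≤n))))
  decodeπ-correct {suc zero} 1<n = cong (decodeπ 0) (cong π (offset-suc-by-1 1<n))
  decodeπ-correct {suc (suc a)} 2+a<n with half (suc (suc a)) 2+a<n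
  ... | near 2+a≤k = begin
    decodeπ (π (suc (suc a))) (π (offset (suc (suc a)) 1)) ≡⟨ cong₂ decodeπ (π-near 2+a≤k) (trans (cong π (offset-suc-by-1 2+a<n)) (π-near (≤-trans (n≤1+n (suc a)) 2+a≤k))) ⟩
    decodeπ (suc a) a                                    ≡⟨ if-≢ {a} {suc (suc a)} (<⇒≢ (<-trans (n<1+n a) (n<1+n (suc a)))) ⟩
    (if does (a ≟ suc a) then suc k else suc (suc a))    ≡⟨ if-≢ {a} {suc a} (<⇒≢ (n<1+n a)) ⟩
    suc (suc a)                                          ∎
    where open ≡-Reasoning
  ... | far zero 2+a+0≡n _ = ⊥-elim (<-irrefl (trans (sym (+-identityʳ (suc (suc a)))) 2+a+0≡n) 2+a<n)
  ... | far (suc u) 2+a+u≡n u<k = begin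
    decodeπ (π (suc (suc a))) (π (offset (suc (suc a)) 1)) ≡⟨ cong₂ decodeπ (π-far {suc a} 2+a+u≡n u<k) (cong π (offset-suc-by-1 2+a<n)) ⟩
    decodeπ (suc u) (π (suc a))                          ≡⟨ decodeπ-far 2+a+u≡n u<k ⟩
    suc (suc a)                                          ∎
    where open ≡-Reasoning

  π-pair-injective : ∀ {a b} → a < n → b < n →
    π a ≡ π b → π (offset a 1) ≡ π (offset b 1) → a ≡ b
  π-pair-injective a<n b<n e e₁ =
    trans (sym (decodeπ-correct a<n)) (trans (cong₂ decodeπ e e₁) (decodeπ-correct b<n))

module Sunlet (k' : ℕ) where
  open Cyclic k'

  G : Graph
  G = sunlet n

  open EdgeDistance G

  Edge : Set
  Edge = Fin (n + n)

  cv pv : Fin n → Fin (n + n)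
  cv i = i ↑ˡ n
  pv i = n ↑ʳ i

  ce pe : Fin n → Edge
  ce i = i ↑ˡ n
  pe i = n ↑ʳ i

  ends-ce : ∀ i → ends G (ce i) ≡ (cv i , cv (cnext i))
  ends-ce i rewrite FinP.splitAt-↑ˡ n i n = refl

  ends-pe : ∀ i → ends G (pe i) ≡ (cv i , pv i)
  ends-pe i rewrite FinP.splitAt-↑ʳ n n i = refl

  ↑ˡ≢↑ʳ : ∀ (a b : Fin n) → a ↑ˡ n ≢ n ↑ʳ b
  ↑ˡ≢↑ʳ a b eq = <⇒≱ (FinP.toℕ<n a) (≤-trans (m≤m+n n (toℕ b))
    (≤-reflexive (trans (sym (FinP.toℕ-↑ʳ n b)) (trans (cong toℕ (sym eq)) (FinP.toℕ-↑ˡ a n)))))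

  ↑ˡ-injective : ∀ {a b : Fin n} → a ↑ˡ n ≡ b ↑ˡ n → a ≡ b
  ↑ˡ-injective {a} {b} = FinP.↑ˡ-injective n a b

  ↑ʳ-injective : ∀ {a b : Fin n} → n ↑ʳ a ≡ n ↑ʳ b → a ≡ b
  ↑ʳ-injective {a} {b} = FinP.↑ʳ-injective n a b

  data Kind : Edge → Set where
    cycle   : ∀ i → Kind (ce i)
    pendant : ∀ i → Kind (pe i)

  kind : ∀ x → Kind x
  kind x = subst Kind (FinP.join-splitAt n n x) (from-split (splitAt n x))
    where
    from-split : (s : Fin n ⊎ Fin n) → Kind (Fin.join n n s)
    from-split (inj₁ i) = cycle i
    from-split (inj₂ i) = pendant i

  toℕ-cnext : ∀ i → toℕ (cnext {n} i) ≡ next (toℕ i)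
  toℕ-cnext i = FinP.toℕ-fromℕ< _

  cnext-injective : ∀ {i j : Fin n} → cnext i ≡ cnext j → i ≡ j
  cnext-injective {i} {j} eq = FinP.toℕ-injective (next-injective (FinP.toℕ<n i) (FinP.toℕ<n j)
    (trans (sym (toℕ-cnext i)) (trans (cong toℕ eq) (toℕ-cnext j))))

  cnext-≢ : ∀ (i : Fin n) → i ≢ cnext i
  cnext-≢ i eq = next-≢ (FinP.toℕ<n i) (trans (cong toℕ eq) (toℕ-cnext i))

  cprev : Fin n → Fin n
  cprev i = fromℕ< (proj₁ (proj₂ (next-onto (FinP.toℕ<n i))))

  cnext-cprev : ∀ i → cnext (cprev i) ≡ i
  cnext-cprev i = FinP.toℕ-injective (trans (toℕ-cnext (cprev i))
    (trans (cong next (FinP.toℕ-fromℕ< (proj₁ (proj₂ (next-onto (FinP.toℕ<n i))))))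
           (proj₂ (proj₂ (next-onto (FinP.toℕ<n i))))))

  Meet : (Fin (n + n) × Fin (n + n)) → (Fin (n + n) × Fin (n + n)) → Set
  Meet (a , b) (c , d) = (a ≡ c) ⊎ (a ≡ d) ⊎ (b ≡ c) ⊎ (b ≡ d)

  to-meet : ∀ x y {p q} → ends G x ≡ p → ends G y ≡ q → SharesEnd G x y → Meet p q
  to-meet _ _ refl refl s = s

  from-meet : ∀ x y {p q} → ends G x ≡ p → ends G y ≡ q → Meet p q → SharesEnd G x y
  from-meet _ _ refl refl s = s

  data Link : Edge → Edge → Set where
    along : ∀ i → Link (ce i) (ce (cnext i))
    own   : ∀ i → Link (pe i) (ce i)
    back  : ∀ i → Link (pe i) (ce (cprev i))

  link-adj : ∀ {x y} → Link x y → LAdj G x y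
  link-adj (along i) = (λ eq → cnext-≢ i (↑ˡ-injective eq)) ,
    from-meet (ce i) (ce (cnext i)) (ends-ce i) (ends-ce (cnext i)) (inj₂ (inj₂ (inj₁ refl)))
  link-adj (own i)   = (λ eq → ↑ˡ≢↑ʳ i i (sym eq)) ,
    from-meet (pe i) (ce i) (ends-pe i) (ends-ce i) (inj₁ refl)
  link-adj (back i)  = (λ eq → ↑ˡ≢↑ʳ (cprev i) i (sym eq)) ,
    from-meet (pe i) (ce (cprev i)) (ends-pe i) (ends-ce (cprev i)) (inj₂ (inj₁ (cong cv (sym (cnext-cprev i)))))

  adj-link : ∀ {x y} → LAdj G x y → Link x y ⊎ Link y x
  adj-link {x} {y} = classify (kind x) (kind y)
    where
    back′ : ∀ {i j} → cnext i ≡ j → Link (pe j) (ce i)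
    back′ {i} refl = subst (λ h → Link (pe (cnext i)) (ce h)) (cnext-injective (cnext-cprev (cnext i))) (back (cnext i))
    classify : ∀ {x y} → Kind x → Kind y → LAdj G x y → Link x y ⊎ Link y x
    classify (cycle i) (cycle j) (x≢y , s) with to-meet (ce i) (ce j) (ends-ce i) (ends-ce j) s
    ... | inj₁ ci≡cj = ⊥-elim (x≢y (cong ce (↑ˡ-injective ci≡cj)))
    ... | inj₂ (inj₁ ci≡cj′) with ↑ˡ-injective ci≡cj′
    ...   | refl = inj₂ (along j)
    classify (cycle i) (cycle j) (x≢y , s) | inj₂ (inj₂ (inj₁ ci′≡cj)) with ↑ˡ-injective ci′≡cj
    ...   | refl = inj₁ (along i)
    classify (cycle i) (cycle j) (x≢y , s) | inj₂ (inj₂ (inj₂ ci′≡cj′)) =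
      ⊥-elim (x≢y (cong ce (cnext-injective (↑ˡ-injective ci′≡cj′))))
    classify (cycle i) (pendant j) (_ , s) with to-meet (ce i) (pe j) (ends-ce i) (ends-pe j) s
    ... | inj₁ ci≡cj with ↑ˡ-injective ci≡cj
    ...   | refl = inj₂ (own i)
    classify (cycle i) (pendant j) (_ , s) | inj₂ (inj₁ ci≡pj)          = ⊥-elim (↑ˡ≢↑ʳ i j ci≡pj)
    classify (cycle i) (pendant j) (_ , s) | inj₂ (inj₂ (inj₁ ci′≡cj)) = inj₂ (back′ (↑ˡ-injective ci′≡cj))
    classify (cycle i) (pendant j) (_ , s) | inj₂ (inj₂ (inj₂ ci′≡pj)) = ⊥-elim (↑ˡ≢↑ʳ (cnext i) j ci′≡pj)
    classify (pendant i) (cycle j) adj = swap (classify (cycle j) (pendant i) (LAdj-sym adj))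
    classify (pendant i) (pendant j) (x≢y , s) with to-meet (pe i) (pe j) (ends-pe i) (ends-pe j) s
    ... | inj₁ ci≡cj                 = ⊥-elim (x≢y (cong pe (↑ˡ-injective ci≡cj)))
    ... | inj₂ (inj₁ ci≡pj)          = ⊥-elim (↑ˡ≢↑ʳ i j ci≡pj)
    ... | inj₂ (inj₂ (inj₁ pi≡cj))   = ⊥-elim (↑ˡ≢↑ʳ j i (sym pi≡cj))
    ... | inj₂ (inj₂ (inj₂ pi≡pj))   = ⊥-elim (x≢y (cong pe (↑ʳ-injective pi≡pj)))

-- Distances in L(S_n) to the cycle edge at index m: a cycle edge at relative position
-- d has distance δ d, a pendant edge distance 1 + π d, certified as a potential.
module ToCycleEdge (k' : ℕ) (m : Fin (Cyclic.n k')) where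
  open Cyclic k'
  open Sunlet k'
  open EdgeDistance G

  pos : Fin n → ℕ
  pos i = offset (toℕ i) (toℕ m)

  pos< : ∀ i → pos i < n
  pos< i = offset< (toℕ i) (toℕ m)

  pos-cnext : ∀ i → pos (cnext i) ≡ next (pos i)
  pos-cnext i = trans (cong (λ z → offset z (toℕ m)) (toℕ-cnext i)) (offset-next (toℕ i) (toℕ m))

  pos-cprev : ∀ i → pos i ≡ next (pos (cprev i))
  pos-cprev i = trans (cong pos (sym (cnext-cprev i))) (pos-cnext (cprev i))

  pot-split : Fin n ⊎ Fin n → ℕ
  pot-split (inj₁ i) = δ (pos i)
  pot-split (inj₂ i) = suc (π (pos i))

  pot : Edge → ℕ
  pot x = pot-split (splitAt n x)

  pot-ce : ∀ i → pot (ce i) ≡ δ (pos i)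
  pot-ce i = cong pot-split (FinP.splitAt-↑ˡ n i n)

  pot-pe : ∀ i → pot (pe i) ≡ suc (π (pos i))
  pot-pe i = cong pot-split (FinP.splitAt-↑ʳ n n i)

  cycle-step : ∀ i → pot (ce (cnext i)) ≡ suc (pot (ce i)) ⊎ pot (ce i) ≡ suc (pot (ce (cnext i)))
  cycle-step i rewrite pot-ce i | pot-ce (cnext i) | pos-cnext i = δ-next (pos< i)

  pot-pendant : ∀ i → pot (pe i) ≡ suc (pot (ce i) ⊓ pot (ce (cprev i)))
  pot-pendant i = begin
    pot (pe i)                                ≡⟨ pot-pe i ⟩
    suc (π (pos i))                           ≡⟨ cong (λ z → suc (π z)) (pos-cprev i) ⟩
    suc (π (next (pos (cprev i))))            ≡⟨ cong suc (π-next (pos< (cprev i))) ⟩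
    suc (δ (next (pos (cprev i))) ⊓ δ (pos (cprev i))) ≡⟨ cong (λ z → suc (δ z ⊓ δ (pos (cprev i)))) (sym (pos-cprev i)) ⟩
    suc (δ (pos i) ⊓ δ (pos (cprev i)))       ≡⟨ cong₂ (λ a b → suc (a ⊓ b)) (sym (pot-ce i)) (sym (pot-ce (cprev i))) ⟩
    suc (pot (ce i) ⊓ pot (ce (cprev i)))     ∎
    where open ≡-Reasoning

  feet-near : ∀ i → pot (ce i) ≤ suc (pot (ce (cprev i))) × pot (ce (cprev i)) ≤ suc (pot (ce i))
  feet-near i = subst (λ j → pot (ce j) ≤ suc (pot (ce (cprev i))) × pot (ce (cprev i)) ≤ suc (pot (ce j)))
                      (cnext-cprev i) (steps-both (cycle-step (cprev i)))

  link-lipschitz : ∀ {x y} → Link x y → pot x ≤ suc (pot y) × pot y ≤ suc (pot x)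
  link-lipschitz (along i) with steps-both (cycle-step i)
  ... | next≤ , ≤next = ≤next , next≤
  link-lipschitz (own i) =
    subst (_≤ suc (pot (ce i))) (sym (pot-pendant i)) (s≤s (m⊓n≤m _ _)) ,
    subst (λ z → pot (ce i) ≤ suc z) (sym (pot-pendant i)) (≤-trans (≤-suc-⊓ˡ (proj₁ (feet-near i))) (n≤1+n _))
  link-lipschitz (back i) =
    subst (_≤ suc (pot (ce (cprev i)))) (sym (pot-pendant i)) (s≤s (m⊓n≤n _ _)) ,
    subst (λ z → pot (ce (cprev i)) ≤ suc z) (sym (pot-pendant i)) (≤-trans (≤-suc-⊓ʳ (proj₂ (feet-near i))) (n≤1+n _))

  pot-lipschitz : ∀ x y → LAdj G x y → pot x ≤ suc (pot y)
  pot-lipschitz x y adj with adj-link adj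
  ... | inj₁ link = proj₁ (link-lipschitz link)
  ... | inj₂ link = proj₂ (link-lipschitz link)

  adj-prev : ∀ i → LAdj G (ce i) (ce (cprev i))
  adj-prev i = LAdj-sym (subst (λ j → LAdj G (ce (cprev i)) (ce j)) (cnext-cprev i) (link-adj (along (cprev i))))

  pot-descent : ∀ x l → pot x ≡ suc l → Σ Edge λ y → LAdj G x y × pot y ≡ l
  pot-descent x l eq = descend-from (kind x) eq
    where
    descend-from : ∀ {x} → Kind x → pot x ≡ suc l → Σ Edge λ y → LAdj G x y × pot y ≡ l
    descend-from (cycle i) eq with δ-descent (pos< i) (trans (sym (pot-ce i)) eq)
    ... | inj₁ δnext≡l = ce (cnext i) , link-adj (along i) ,
          trans (pot-ce (cnext i)) (trans (cong δ (pos-cnext i)) δnext≡l)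
    ... | inj₂ (d , pos≡1+d , δd≡l) = ce (cprev i) , adj-prev i ,
          trans (pot-ce (cprev i)) (trans (cong δ (next-suc (pos< (cprev i)) (trans (sym (pos-cprev i)) pos≡1+d))) δd≡l)
    descend-from (pendant i) eq = to-lower-foot (⊓-sel (pot (ce i)) (pot (ce (cprev i))))
      where
      a b : ℕ
      a = pot (ce i)
      b = pot (ce (cprev i))
      min≡l : a ⊓ b ≡ l
      min≡l = suc-injective (trans (sym (pot-pendant i)) eq)
      to-lower-foot : a ⊓ b ≡ a ⊎ a ⊓ b ≡ b → Σ Edge λ y → LAdj G (pe i) y × pot y ≡ l
      to-lower-foot (inj₁ min≡a) = ce i , link-adj (own i) , trans (sym min≡a) min≡l
      to-lower-foot (inj₂ min≡b) = ce (cprev i) , link-adj (back i) , trans (sym min≡b) min≡l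

  pot-zero : ∀ x → pot x ≡ 0 → x ≡ ce m
  pot-zero x = zero-at (kind x)
    where
    zero-at : ∀ {x} → Kind x → pot x ≡ 0 → x ≡ ce m
    zero-at (cycle i) eq = cong ce (FinP.toℕ-injective
      (offset-zero (FinP.toℕ<n i) (FinP.toℕ<n m) (δ-zero (pos< i) (trans (sym (pot-ce i)) eq))))
    zero-at (pendant i) eq = ⊥-elim (1+n≢0 (trans (sym (pot-pe i)) eq))

  pot-target : pot (ce m) ≡ 0
  pot-target = trans (pot-ce m) (cong δ (offset-self (FinP.toℕ<n m)))

  open Potential (ce m) pot pot-zero pot-target pot-lipschitz pot-descent public

  pot≤k : ∀ x → pot x ≤ k
  pot≤k x = bound (kind x)
    where
    bound : ∀ {x} → Kind x → pot x ≤ k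
    bound (cycle i)   = subst (_≤ k) (sym (pot-ce i)) (δ≤k (pos< i))
    bound (pendant i) = subst (_≤ k) (sym (pot-pe i)) (π<k (pos< i))

module SunletLowerBound (k' : ℕ) where
  open Cyclic k'
  open Sunlet k'
  open EdgeDistance G
  module To (j : Fin n) = ToCycleEdge k' j

  -- Every edge reaches every other one by a walk of length at most k + 1: walk down to
  -- the cycle edge at the foot of the target, then step onto the target if it is pendant.
  short-walk : ∀ x y → Σ ℕ λ l → LWalk G x y l × l ≤ suc k
  short-walk x y = towards (kind y)
    where
    towards : ∀ {y} → Kind y → Σ ℕ λ l → LWalk G x y l × l ≤ suc k
    towards (cycle j)   = To.pot j x , proj₁ (To.potential-dist j x) , ≤-trans (To.pot≤k j x) (n≤1+n k)
    towards (pendant j) = To.pot j x + 1 ,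
      append (proj₁ (To.potential-dist j x)) (step (LAdj-sym (link-adj (own j))) here) ,
      subst (To.pot j x + 1 ≤_) (+-comm k 1) (+-monoˡ-≤ 1 (To.pot≤k j x))

  diameter : ∀ x y → Σ ℕ λ d → EdgeDist G x y d × d ≤ suc k
  diameter x y = dist-from-walk′ (short-walk x y)
    where
    dist-from-walk′ : (Σ ℕ λ l → LWalk G x y l × l ≤ suc k) → Σ ℕ λ d → EdgeDist G x y d × d ≤ suc k
    dist-from-walk′ (l , w , l≤) with dist-from-walk w
    ... | d , dist , d≤l = d , dist , ≤-trans d≤l l≤

  many-edges : suc (suc k + suc k) < n + n
  many-edges = subst (_≤ n + n) (cong (λ z → suc (suc z)) (sym (+-suc (suc k) k)))
                 (+-monoˡ-≤ n (+-mono-≤ {2} {k} {2} {k} (s≤s (s≤s z≤n)) (s≤s (s≤s z≤n))))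

  open LowerBound G (λ x y → proj₁ (diameter x y)) (λ x y → proj₁ (proj₂ (diameter x y)))
                    (suc k) (λ x y → proj₂ (proj₂ (diameter x y))) many-edges public

module SunletUpperBound (k' : ℕ) where
  open Cyclic k'
  open Sunlet k'
  open DoubleResolution G

  i₀ i₁ iₖ : Fin n
  i₀ = Fin.zero
  i₁ = Fin.suc Fin.zero
  iₖ = fromℕ< (m<m+n k (s≤s z≤n))

  module T₀ = ToCycleEdge k' i₀
  module T₁ = ToCycleEdge k' i₁
  module Tₖ = ToCycleEdge k' iₖ

  d₀ d₁ dₖ : Edge → ℕ
  d₀ = T₀.pot
  d₁ = T₁.pot
  dₖ = Tₖ.pot

  toℕ-iₖ : toℕ iₖ ≡ k
  toℕ-iₖ = FinP.toℕ-fromℕ< (m<m+n k (s≤s z≤n))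

  sum-ce : ∀ i → d₀ (ce i) + dₖ (ce i) ≡ k + 0
  sum-ce i = begin
    d₀ (ce i) + dₖ (ce i)                        ≡⟨ cong₂ _+_ (T₀.pot-ce i) (Tₖ.pot-ce i) ⟩
    δ (T₀.pos i) + δ (Tₖ.pos i)                  ≡⟨ cong₂ (λ a b → δ a + δ (offset (toℕ i) b)) (offset-by-0 (FinP.toℕ<n i)) toℕ-iₖ ⟩
    δ (toℕ i) + δ (offset (toℕ i) k)             ≡⟨ by-antipode δ δ-antipode (FinP.toℕ<n i) ⟩
    k                                            ≡⟨ +-identityʳ k ⟨
    k + 0                                        ∎
    where open ≡-Reasoning

  sum-pe : ∀ i → d₀ (pe i) + dₖ (pe i) ≡ k + 1
  sum-pe i = begin
    d₀ (pe i) + dₖ (pe i)                        ≡⟨ cong₂ _+_ (T₀.pot-pe i) (Tₖ.pot-pe i) ⟩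
    suc (π (T₀.pos i)) + suc (π (Tₖ.pos i))      ≡⟨ cong₂ (λ a b → suc (π a) + suc (π (offset (toℕ i) b))) (offset-by-0 (FinP.toℕ<n i)) toℕ-iₖ ⟩
    suc (π (toℕ i)) + suc (π (offset (toℕ i) k)) ≡⟨ cong suc (+-suc (π (toℕ i)) _) ⟩
    suc (suc (π (toℕ i) + π (offset (toℕ i) k))) ≡⟨ cong (λ z → suc (suc z)) (by-antipode π π-antipode (FinP.toℕ<n i)) ⟩
    suc k                                        ≡⟨ +-comm 1 k ⟩
    k + 1                                        ∎
    where open ≡-Reasoning

  d₀-ce : ∀ i → d₀ (ce i) ≡ δ (toℕ i)
  d₀-ce i = trans (T₀.pot-ce i) (cong δ (offset-by-0 (FinP.toℕ<n i)))

  d₀-pe : ∀ i → d₀ (pe i) ≡ suc (π (toℕ i))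
  d₀-pe i = trans (T₀.pot-pe i) (cong (λ z → suc (π z)) (offset-by-0 (FinP.toℕ<n i)))

  d₁-agree : ∀ {x y} → d₁ x + d₀ y ≡ d₁ y + d₀ x → d₀ x ≡ d₀ y → d₁ x ≡ d₁ y
  d₁-agree {x} {y} e₁ e₀ = +-cancelʳ-≡ (d₀ y) _ _ (trans e₁ (cong (λ v → d₁ y + v) e₀))

  -- Edges unresolved by (e_k, e₀) have the same kind and the same distance to e₀, since
  -- d₀ + d_k is k or k + 1 according to the kind.
  kinds-balance : ∀ x y {s t} → d₀ x + dₖ x ≡ k + s → d₀ y + dₖ y ≡ k + t →
    dₖ x + d₀ y ≡ dₖ y + d₀ x → s + 2 * d₀ y ≡ t + 2 * d₀ x
  kinds-balance x y {s} {t} = balance {d₀ x} {d₀ y} {dₖ x} {dₖ y} {k} {s} {t}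

  same-kind-ce : ∀ {i j} → dₖ (ce i) + d₀ (ce j) ≡ dₖ (ce j) + d₀ (ce i) → d₀ (ce i) ≡ d₀ (ce j)
  same-kind-ce {i} {j} eₖ = sym (*-cancelˡ-≡ _ _ 2 (kinds-balance (ce i) (ce j) (sum-ce i) (sum-ce j) eₖ))

  same-kind-pe : ∀ {i j} → dₖ (pe i) + d₀ (pe j) ≡ dₖ (pe j) + d₀ (pe i) → d₀ (pe i) ≡ d₀ (pe j)
  same-kind-pe {i} {j} eₖ = sym (*-cancelˡ-≡ _ _ 2 (suc-injective (kinds-balance (pe i) (pe j) (sum-pe i) (sum-pe j) eₖ)))

  -- Hence edges unresolved by both pairs coincide: (d₀, d₁) determines the index.
  signature-injective : ∀ x y → d₁ x + d₀ y ≡ d₁ y + d₀ x → dₖ x + d₀ y ≡ dₖ y + d₀ x → x ≡ y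
  signature-injective x y = by-kind (kind x) (kind y)
    where
    by-kind : ∀ {x y} → Kind x → Kind y → d₁ x + d₀ y ≡ d₁ y + d₀ x → dₖ x + d₀ y ≡ dₖ y + d₀ x → x ≡ y
    by-kind (cycle i) (cycle j) e₁ eₖ = cong ce (FinP.toℕ-injective (δ-pair-injective (FinP.toℕ<n i) (FinP.toℕ<n j)
      (trans (sym (d₀-ce i)) (trans e₀ (d₀-ce j)))
      (trans (sym (T₁.pot-ce i)) (trans (d₁-agree {ce i} {ce j} e₁ e₀) (T₁.pot-ce j)))))
      where
      e₀ : d₀ (ce i) ≡ d₀ (ce j)
      e₀ = same-kind-ce {i} {j} eₖ
    by-kind (pendant i) (pendant j) e₁ eₖ = cong pe (FinP.toℕ-injective (π-pair-injective (FinP.toℕ<n i) (FinP.toℕ<n j)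
      (suc-injective (trans (sym (d₀-pe i)) (trans e₀ (d₀-pe j))))
      (suc-injective (trans (sym (T₁.pot-pe i)) (trans (d₁-agree {pe i} {pe j} e₁ e₀) (T₁.pot-pe j))))))
      where
      e₀ : d₀ (pe i) ≡ d₀ (pe j)
      e₀ = same-kind-pe {i} {j} eₖ
    by-kind (cycle i)   (pendant j) e₁ eₖ = ⊥-elim (even≢odd (d₀ (pe j)) (d₀ (ce i)) (kinds-balance (ce i) (pe j) (sum-ce i) (sum-pe j) eₖ))
    by-kind (pendant i) (cycle j)   e₁ eₖ = ⊥-elim (even≢odd (d₀ (pe i)) (d₀ (ce j)) (sym (kinds-balance (pe i) (ce j) (sum-pe i) (sum-ce j) eₖ)))

  pair basis : Subset (n + n)
  pair  = ⁅ ce i₀ ⁆ ∪ ⁅ ce i₁ ⁆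
  basis = pair ∪ ⁅ ce iₖ ⁆

  ∈-basis₀ : ce i₀ ∈ basis
  ∈-basis₀ = x∈p∪q⁺ {p = pair} {q = ⁅ ce iₖ ⁆} (inj₁ (x∈p∪q⁺ {p = ⁅ ce i₀ ⁆} {q = ⁅ ce i₁ ⁆} (inj₁ (x∈⁅x⁆ (ce i₀)))))

  ∈-basis₁ : ce i₁ ∈ basis
  ∈-basis₁ = x∈p∪q⁺ {p = pair} {q = ⁅ ce iₖ ⁆} (inj₁ (x∈p∪q⁺ {p = ⁅ ce i₀ ⁆} {q = ⁅ ce i₁ ⁆} (inj₂ (x∈⁅x⁆ (ce i₁)))))

  ∈-basisₖ : ce iₖ ∈ basis
  ∈-basisₖ = x∈p∪q⁺ {p = pair} {q = ⁅ ce iₖ ⁆} (inj₂ (x∈⁅x⁆ (ce iₖ)))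

  ce-index : ∀ {i j} → ce i ≡ ce j → toℕ i ≡ toℕ j
  ce-index {i} {j} eq = cong toℕ (↑ˡ-injective eq)

  ∣basis∣ : ∣ basis ∣ ≡ 3
  ∣basis∣ = begin
    ∣ pair ∪ ⁅ ce iₖ ⁆ ∣               ≡⟨ ∣∪⁅x⁆∣ pair (ce iₖ) iₖ∉ ⟩
    suc ∣ ⁅ ce i₀ ⁆ ∪ ⁅ ce i₁ ⁆ ∣       ≡⟨ cong suc (∣∪⁅x⁆∣ ⁅ ce i₀ ⁆ (ce i₁) i₁∉) ⟩
    suc (suc ∣ ⁅ ce i₀ ⁆ ∣)            ≡⟨ cong (λ z → suc (suc z)) (∣⁅x⁆∣≡1 (ce i₀)) ⟩
    3                                  ∎
    where
    open ≡-Reasoning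
    i₁∉ : ce i₁ ∉ ⁅ ce i₀ ⁆
    i₁∉ p = 1+n≢0 (ce-index (x∈⁅y⁆⇒x≡y (ce i₀) p))
    iₖ∉ : ce iₖ ∉ pair
    iₖ∉ p with x∈p∪q⁻ ⁅ ce i₀ ⁆ ⁅ ce i₁ ⁆ p
    ... | inj₁ p₀ = 1+n≢0 (trans (sym toℕ-iₖ) (ce-index (x∈⁅y⁆⇒x≡y (ce i₀) p₀)))
    ... | inj₂ p₁ = 1+n≢0 (suc-injective (trans (sym toℕ-iₖ) (ce-index (x∈⁅y⁆⇒x≡y (ce i₁) p₁))))

  basis-resolving : IsEdgeDRS G basis
  basis-resolving x y x≢y with (d₁ x + d₀ y) ≟ (d₁ y + d₀ x)
  ... | no unbalanced₁ = ce i₁ , ce i₀ , ∈-basis₁ , ∈-basis₀ ,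
        resolves (T₁.potential-dist x) (T₀.potential-dist x) (T₁.potential-dist y) (T₀.potential-dist y) unbalanced₁
  ... | yes balanced₁ with (dₖ x + d₀ y) ≟ (dₖ y + d₀ x)
  ...   | no unbalancedₖ = ce iₖ , ce i₀ , ∈-basisₖ , ∈-basis₀ ,
          resolves (Tₖ.potential-dist x) (T₀.potential-dist x) (Tₖ.potential-dist y) (T₀.potential-dist y) unbalancedₖ
  ...   | yes balancedₖ = ⊥-elim (x≢y (signature-injective x y balanced₁ balancedₖ))

lemma2p2 : (k : ℕ) → 2 ≤ k → PsiE≡ (sunlet (k + k)) 3
lemma2p2 (suc zero) (s≤s ())
lemma2p2 (suc (suc k')) _ = (basis , basis-resolving , ∣basis∣) , at-least-three
  where
  open SunletUpperBound k'
  open SunletLowerBound k'
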